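{- For every $n\ge 3$, $\sum_{k=0}^{n} r_{n,k}=2F_n$.
   Context: For $n\ge 0$, the $S$-fence $\phi_n$ is the poset on $\{x_1,\dots,x_n\}$ whose order is generated by the cover relations $x_2<x_1$, $x_3<x_2$, $x_2<x_4$, $x_5<x_4$, and, for every $i\ge 3$, $x_{2i-1}<x_{2i}$ and $x_{2i+1}<x_{2i}$, keeping only those relations whose elements both have index $\le n$. A filter is an up-set. $\mathcal{F}(\phi_n)$ is the set of filters of $\phi_n$ ordered by reverse inclusion; the rank of a filter $Y$ is $n-|Y|$, and $r_{n,k}$ is the number of elements of rank $k$ in $\mathcal{F}(\phi_n)$. $F_n$ is the Fibonacci number: $F_0=0$, $F_1=1$, $F_n=F_{n-1}+F_{n-2}$. -}

module Defs where

open import Data.Nat using (ℕ; zero; suc; _+_; _*_; _∸_)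
open import Data.Fin using (Fin; toℕ)
open import Data.Fin.Subset using (Subset; _∈_; ∣_∣)
open import Data.Product using (Σ; _×_)
open import Data.Irrelevant using (Irrelevant)
open import Relation.Binary.PropositionalEquality using (_≡_)
open import Relation.Binary.Construct.Closure.ReflexiveTransitive using (Star)

fib : ℕ → ℕ
fib zero = 0
fib (suc zero) = 1
fib (suc (suc n)) = fib (suc n) + fib n

-- Cover relations of the S-fence on 1-based indices: Cov a b means x_a < x_b.
--   x2<x1, x3<x2, x2<x4, x5<x4, and for i ≥ 3 (i = j + 3):
--   x_{2i-1} < x_{2i}  (i.e. x_{5+2j} < x_{6+2j}),
--   x_{2i+1} < x_{2i}  (i.e. x_{7+2j} < x_{6+2j}).
data Cov : ℕ → ℕ → Set where
  c21 : Cov 2 1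
  c32 : Cov 3 2
  c24 : Cov 2 4
  c54 : Cov 5 4
  cOdd↑  : ∀ j → Cov (5 + 2 * j) (6 + 2 * j)
  cOdd↑' : ∀ j → Cov (7 + 2 * j) (6 + 2 * j)

-- Elements of φ_n: x_1 … x_n, with x_i represented by the index i-1 : Fin n.
CovF : (n : ℕ) → Fin n → Fin n → Set
CovF n a b = Cov (suc (toℕ a)) (suc (toℕ b))

Order : (n : ℕ) → Fin n → Fin n → Set
Order n = Star (CovF n)

IsFilter : (n : ℕ) → Subset n → Set
IsFilter n Y = ∀ x y → Order n x y → x ∈ Y → y ∈ Y

rank : (n : ℕ) → Subset n → ℕ
rank n Y = n ∸ ∣ Y ∣

-- The set of elements of rank k in F(φ_n) (filter proof irrelevant, so that
-- distinct elements are exactly distinct subsets).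
FiltersOfRank : ℕ → ℕ → Set
FiltersOfRank n k = Σ (Subset n) (λ Y → Irrelevant (IsFilter n Y) × rank n Y ≡ k)

sumTo : ℕ → (ℕ → ℕ) → ℕ
sumTo zero f = f 0
sumTo (suc n) f = sumTo n f + f (suc n)

-- For n ≥ 3 the S-fence φ_n is the zigzag x₁ > x₂ < x₄ > x₅ < x₆ > ⋯ with x₃
-- hanging below x₂.  A subset is a filter iff it is closed under the cover
-- relations, which can be checked along the zigzag by a Boolean test.  A fence
-- on m further elements after a given first element has F(m+1) filters if that
-- element forces its neighbour and F(m+2) otherwise.  If x₂ ∈ Y then x₁ ∈ Y
-- and x₃ is free, giving 2F(m+1) filters; otherwise x₃ ∉ Y and x₁ is free,
-- giving 2F(m+2); in total 2F(m+3) = 2F(n).  Every filter has rank at most n,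
-- so summing r_{n,k} over k ≤ n counts all filters.

module Submission where

open import Defs
open import Data.Nat using (ℕ; zero; suc; _+_; _*_; _≤_; _<_; z≤n; s≤s; _≡ᵇ_)
open import Data.Nat.Properties using (+-assoc; +-comm; +-identityʳ; ≤-refl; m≤n⇒m≤1+n; *-suc; m∸n≤m; ≡-irrelevant; ≡ᵇ⇒≡; ≡⇒≡ᵇ)
open import Data.Nat.Tactic.RingSolver using (solve-∀)
open import Data.Bool using (Bool; true; false; T; _∧_; if_then_else_)
open import Data.Bool.Properties using (T-∧; T-irrelevant; T?)
open import Data.Unit using (tt)
open import Data.Sum using (_⊎_; inj₁; inj₂)
open import Data.Sum.Function.Propositional using (_⊎-cong_)
open import Data.Product using (Σ; ∃; _,_; proj₁; proj₂)
open import Data.Fin using (Fin; toℕ; fromℕ<) renaming (zero to fzero; suc to fsuc)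
open import Data.Fin.Properties using (toℕ<n; toℕ-fromℕ<; +↔⊎)
open import Data.Fin.Permutation using (↔⇒≡)
open import Data.Fin.Subset using (Subset; _∈_; ∣_∣)
open import Data.Irrelevant using ([_])
open import Data.Vec using (Vec; []; _∷_; here; there)
open import Function using (_∘_; id)
open import Function.Bundles using (_↔_; _⇔_; mk↔ₛ′; mk⇔; Equivalence)
open import Function.Properties.Inverse using (↔-trans; ↔-sym)
open import Relation.Binary.Construct.Closure.ReflexiveTransitive using (ε; _◅_; fold)
open import Relation.Binary.PropositionalEquality using (_≡_; refl; sym; trans; cong; cong₂; subst; module ≡-Reasoning)
open import Relation.Nullary using (Irrelevant)
open import Relation.Nullary.Decidable using (recompute)

open Equivalence using (to; from)

private
  variable
    m n N a b x : ℕ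

infixr 4 _→ᵇ_

_→ᵇ_ : Bool → Bool → Bool
true  →ᵇ y = y
false →ᵇ _ = true

T-→ᵇ : ∀ {x y} → T (x →ᵇ y) ⇔ (T x → T y)
T-→ᵇ {true}  = mk⇔ (λ t _ → t) (λ f → f tt)
T-→ᵇ {false} = mk⇔ (λ _ ()) (λ _ → tt)

sumTo-cong : (f g : ℕ → ℕ) → (∀ k → k ≤ N → f k ≡ g k) → sumTo N f ≡ sumTo N g
sumTo-cong {zero}  f g f≗g = f≗g 0 z≤n
sumTo-cong {suc N} f g f≗g =
  cong₂ _+_ (sumTo-cong f g (λ k k≤N → f≗g k (m≤n⇒m≤1+n k≤N)))
            (f≗g (suc N) ≤-refl)

sumTo-+ : (f g : ℕ → ℕ) → sumTo N (λ k → f k + g k) ≡ sumTo N f + sumTo N g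
sumTo-+ {zero}  f g = refl
sumTo-+ {suc N} f g rewrite sumTo-+ {N} f g = interchange (sumTo N f) (sumTo N g) (f (suc N)) (g (suc N))
  where
  interchange : ∀ p q r s → (p + q) + (r + s) ≡ (p + r) + (q + s)
  interchange = solve-∀

sumTo-zero : sumTo N (λ _ → 0) ≡ 0
sumTo-zero {zero}  = refl
sumTo-zero {suc N} = trans (+-identityʳ _) (sumTo-zero {N})

sumTo-suc : (f : ℕ → ℕ) → sumTo (suc N) f ≡ f 0 + sumTo N (f ∘ suc)
sumTo-suc {zero}  f = refl
sumTo-suc {suc N} f = trans (cong (_+ f (2 + N)) (sumTo-suc f)) (+-assoc (f 0) _ _)

sumTo-≡ᵇ : x ≤ N → sumTo N (λ k → if x ≡ᵇ k then 1 else 0) ≡ 1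
sumTo-≡ᵇ {zero}  {zero}  z≤n       = refl
sumTo-≡ᵇ {zero}  {suc N} z≤n       = trans (+-identityʳ _) (sumTo-≡ᵇ {0} {N} z≤n)
sumTo-≡ᵇ {suc x} {suc N} (s≤s x≤N) = trans (sumTo-suc {N} _) (sumTo-≡ᵇ x≤N)

sumTo-indicator : ∀ p → x ≤ N → sumTo N (λ k → if p ∧ (x ≡ᵇ k) then 1 else 0) ≡ (if p then 1 else 0)
sumTo-indicator true  = sumTo-≡ᵇ
sumTo-indicator {N = N} false _ = sumTo-zero {N}

count : (Vec Bool m → Bool) → ℕ
count {zero}  p = if p [] then 1 else 0
count {suc m} p = count (λ v → p (true ∷ v)) + count (λ v → p (false ∷ v))

count-false : count {m} (λ _ → false) ≡ 0
count-false {zero}  = refl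
count-false {suc m} = cong₂ _+_ (count-false {m}) (count-false {m})

T↔Fin : ∀ p → T p ↔ Fin (if p then 1 else 0)
T↔Fin true  = mk↔ₛ′ (λ _ → fzero) (λ _ → tt) (λ { fzero → refl ; (fsuc ()) }) (λ _ → refl)
T↔Fin false = mk↔ₛ′ (λ ()) (λ ()) (λ ()) (λ ())

Σ-Vec-suc↔⊎ : (P : Vec Bool (suc m) → Set) →
  Σ (Vec Bool (suc m)) P ↔ (Σ (Vec Bool m) (P ∘ (true ∷_)) ⊎ Σ (Vec Bool m) (P ∘ (false ∷_)))
Σ-Vec-suc↔⊎ P = mk↔ₛ′ split join
  (λ { (inj₁ _) → refl ; (inj₂ _) → refl })
  (λ { (true ∷ _ , _) → refl ; (false ∷ _ , _) → refl })
  where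
  split : Σ _ P → Σ _ (P ∘ (true ∷_)) ⊎ Σ _ (P ∘ (false ∷_))
  split (true  ∷ v , p) = inj₁ (v , p)
  split (false ∷ v , p) = inj₂ (v , p)
  join : Σ _ (P ∘ (true ∷_)) ⊎ Σ _ (P ∘ (false ∷_)) → Σ _ P
  join (inj₁ (v , p)) = true  ∷ v , p
  join (inj₂ (v , p)) = false ∷ v , p

Σ-T↔count : (p : Vec Bool m → Bool) → Σ (Vec Bool m) (T ∘ p) ↔ Fin (count p)
Σ-T↔count {zero} p = ↔-trans Σ-[]↔ (T↔Fin (p []))
  where
  Σ-[]↔ : Σ (Vec Bool 0) (T ∘ p) ↔ T (p [])
  Σ-[]↔ = mk↔ₛ′ (λ { ([] , t) → t }) ([] ,_) (λ _ → refl) (λ { ([] , _) → refl })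
Σ-T↔count {suc m} p = ↔-trans (Σ-Vec-suc↔⊎ (T ∘ p))
  (↔-trans (Σ-T↔count (λ v → p (true ∷ v)) ⊎-cong Σ-T↔count (λ v → p (false ∷ v))) (↔-sym +↔⊎))

count-fibres : (p : Vec Bool m → Bool) (g : Vec Bool m → ℕ) → (∀ v → g v ≤ N) →
  sumTo N (λ k → count (λ v → p v ∧ (g v ≡ᵇ k))) ≡ count p
count-fibres {zero}      p g g≤N = sumTo-indicator (p []) (g≤N [])
count-fibres {suc m} {N} p g g≤N = trans (sumTo-+ {N} _ _)
  (cong₂ _+_ (count-fibres _ _ (g≤N ∘ (true ∷_))) (count-fibres _ _ (g≤N ∘ (false ∷_))))

-- Positions past the end read as false, so UpClosed only bounds the upper end of a cover.
_‼_ : Vec Bool n → ℕ → Bool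
[]      ‼ _     = false
(y ∷ _) ‼ zero  = y
(_ ∷ Y) ‼ suc i = Y ‼ i

‼-bound : (Y : Vec Bool n) → T (Y ‼ a) → a < n
‼-bound {a = zero}  (_ ∷ Y) _ = s≤s z≤n
‼-bound {a = suc a} (_ ∷ Y) t = s≤s (‼-bound Y t)

∈⇒‼ : {Y : Subset n} {i : Fin n} → i ∈ Y → T (Y ‼ toℕ i)
∈⇒‼ here      = tt
∈⇒‼ (there i) = ∈⇒‼ i

‼⇒∈ : (Y : Subset n) (i : Fin n) → T (Y ‼ toℕ i) → i ∈ Y
‼⇒∈ (true ∷ Y) fzero    _ = here
‼⇒∈ (_ ∷ Y)    (fsuc i) t = there (‼⇒∈ Y i t)

toℕ-onto : a < n → ∃ λ (i : Fin n) → toℕ i ≡ a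
toℕ-onto a<n = fromℕ< a<n , toℕ-fromℕ< a<n

UpClosed : (ℕ → ℕ → Set) → Vec Bool n → Set
UpClosed {n} R Y = ∀ {a b} → R a b → b < n → T (Y ‼ a) → T (Y ‼ b)

Cov₀ : ℕ → ℕ → Set
Cov₀ a b = Cov (suc a) (suc b)

isFilter⇔upClosed : (Y : Subset n) → IsFilter n Y ⇔ UpClosed Cov₀ Y
isFilter⇔upClosed {n} Y = mk⇔ filter⇒closed closed⇒filter
  where
  filter⇒closed : IsFilter n Y → UpClosed Cov₀ Y
  filter⇒closed F c b<n yₐ with toℕ-onto (‼-bound Y yₐ) | toℕ-onto b<n
  ... | i , refl | j , refl = ∈⇒‼ (F i j (c ◅ ε) (‼⇒∈ Y i yₐ))
  closed⇒filter : UpClosed Cov₀ Y → IsFilter n Y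
  closed⇒filter cl _ _ = fold (λ i j → i ∈ Y → j ∈ Y)
    (λ {_} {j} c onward → onward ∘ ‼⇒∈ Y j ∘ cl c (toℕ<n j) ∘ ∈⇒‼) id

-- Covers w_a < w_b of the infinite fences w₀ > w₁ < w₂ > ⋯ (PeakCov) and w₀ < w₁ > w₂ < ⋯ (ValleyCov).
data PeakCov : ℕ → ℕ → Set
data ValleyCov : ℕ → ℕ → Set

data PeakCov where
  first : PeakCov 1 0
  next  : ValleyCov a b → PeakCov (suc a) (suc b)

data ValleyCov where
  first : ValleyCov 0 1
  next  : PeakCov a b → ValleyCov (suc a) (suc b)

fenceFromPeak fenceFromValley : Bool → Vec Bool m → Bool
fenceFromPeak   _ []      = true
fenceFromPeak   x (y ∷ v) = (y →ᵇ x) ∧ fenceFromValley y v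
fenceFromValley _ []      = true
fenceFromValley x (y ∷ v) = (x →ᵇ y) ∧ fenceFromPeak y v

fromPeak⇒upClosed   : ∀ {x} {v : Vec Bool m} → T (fenceFromPeak x v) → UpClosed PeakCov (x ∷ v)
fromValley⇒upClosed : ∀ {x} {v : Vec Bool m} → T (fenceFromValley x v) → UpClosed ValleyCov (x ∷ v)
fromPeak⇒upClosed   {v = []}    _ first    _         ()
fromPeak⇒upClosed   {v = []}    _ (next _) (s≤s ())
fromPeak⇒upClosed   {v = _ ∷ _} t first    _         = to T-→ᵇ (proj₁ (to T-∧ t))
fromPeak⇒upClosed   {v = _ ∷ _} t (next c) (s≤s b<m) = fromValley⇒upClosed (proj₂ (to T-∧ t)) c b<m
fromValley⇒upClosed {v = []}    _ first    (s≤s ())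
fromValley⇒upClosed {v = []}    _ (next _) (s≤s ())
fromValley⇒upClosed {v = _ ∷ _} t first    _         = to T-→ᵇ (proj₁ (to T-∧ t))
fromValley⇒upClosed {v = _ ∷ _} t (next c) (s≤s b<m) = fromPeak⇒upClosed (proj₂ (to T-∧ t)) c b<m

upClosed⇒fromPeak   : ∀ {x} {v : Vec Bool m} → UpClosed PeakCov (x ∷ v) → T (fenceFromPeak x v)
upClosed⇒fromValley : ∀ {x} {v : Vec Bool m} → UpClosed ValleyCov (x ∷ v) → T (fenceFromValley x v)
upClosed⇒fromPeak {v = []} _ = tt
upClosed⇒fromPeak {v = _ ∷ _} cl = from T-∧
  (from T-→ᵇ (cl first (s≤s z≤n)) , upClosed⇒fromValley (λ c b<m → cl (next c) (s≤s b<m)))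
upClosed⇒fromValley {v = []} _ = tt
upClosed⇒fromValley {v = _ ∷ _} cl = from T-∧
  (from T-→ᵇ (cl first (s≤s (s≤s z≤n))) , upClosed⇒fromPeak (λ c b<m → cl (next c) (s≤s b<m)))

count-fromPeak-true    : count {m} (fenceFromPeak true)    ≡ fib (2 + m)
count-fromPeak-false   : count {m} (fenceFromPeak false)   ≡ fib (1 + m)
count-fromValley-true  : count {m} (fenceFromValley true)  ≡ fib (1 + m)
count-fromValley-false : count {m} (fenceFromValley false) ≡ fib (2 + m)
count-fromPeak-true    {zero}  = refl
count-fromPeak-true    {suc m} rewrite count-fromValley-true {m} | count-fromValley-false {m} = +-comm (fib (1 + m)) _
count-fromPeak-false   {zero}  = refl
count-fromPeak-false   {suc m} rewrite count-false {m} | count-fromValley-false {m} = refl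
count-fromValley-true  {zero}  = refl
count-fromValley-true  {suc m} rewrite count-false {m} | count-fromPeak-true {m} = +-identityʳ _
count-fromValley-false {zero}  = refl
count-fromValley-false {suc m} rewrite count-fromPeak-true {m} | count-fromPeak-false {m} = refl

peak-rising : ∀ j → PeakCov (1 + 2 * j) (2 + 2 * j)
peak-rising zero    = next first
peak-rising (suc j) = subst (λ k → PeakCov (1 + k) (2 + k)) (sym (*-suc 2 j)) (next (next (peak-rising j)))

peak-falling : ∀ j → PeakCov (3 + 2 * j) (2 + 2 * j)
peak-falling zero    = next (next first)
peak-falling (suc j) = subst (λ k → PeakCov (3 + k) (2 + k)) (sym (*-suc 2 j)) (next (next (peak-falling j)))

Cov⇒PeakCov : Cov (4 + a) (4 + b) → PeakCov a b
Cov⇒PeakCov c54        = first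
Cov⇒PeakCov (cOdd↑ j)  = peak-rising j
Cov⇒PeakCov (cOdd↑' j) = peak-falling j

Cov-shift : Cov (4 + a) (4 + b) → Cov (6 + a) (6 + b)
Cov-shift c54        = cOdd↑' 0
Cov-shift (cOdd↑ j)  = subst (λ k → Cov (5 + k) (6 + k)) (*-suc 2 j) (cOdd↑ (suc j))
Cov-shift (cOdd↑' j) = subst (λ k → Cov (7 + k) (6 + k)) (*-suc 2 j) (cOdd↑' (suc j))

PeakCov⇒Cov : PeakCov a b → Cov (4 + a) (4 + b)
PeakCov⇒Cov first             = c54
PeakCov⇒Cov (next first)      = cOdd↑ 0
PeakCov⇒Cov (next (next c))   = Cov-shift (PeakCov⇒Cov c)

isFilterᵇ : Vec Bool (3 + m) → Bool
isFilterᵇ (x₁ ∷ x₂ ∷ x₃ ∷ v) = (x₂ →ᵇ x₁) ∧ (x₃ →ᵇ x₂) ∧ fenceFromValley x₂ v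

isFilterᵇ⇒upClosed : (Y : Vec Bool (3 + m)) → T (isFilterᵇ Y) → UpClosed Cov₀ Y
isFilterᵇ⇒upClosed (x₁ ∷ x₂ ∷ x₃ ∷ v) t = closed
  where
  t₂₃ : T ((x₃ →ᵇ x₂) ∧ fenceFromValley x₂ v)
  t₂₃ = proj₂ (to (T-∧ {x₂ →ᵇ x₁}) t)
  tail : UpClosed ValleyCov (x₂ ∷ v)
  tail = fromValley⇒upClosed (proj₂ (to T-∧ t₂₃))
  closed : UpClosed Cov₀ (x₁ ∷ x₂ ∷ x₃ ∷ v)
  closed c21          _                     = to T-→ᵇ (proj₁ (to T-∧ t))
  closed c32          _                     = to T-→ᵇ (proj₁ (to T-∧ t₂₃))
  closed c24          (s≤s (s≤s (s≤s 1≤m))) = tail first (s≤s 1≤m)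
  closed c@c54        (s≤s (s≤s (s≤s b<m))) = tail (next (Cov⇒PeakCov c)) (s≤s b<m)
  closed c@(cOdd↑ _)  (s≤s (s≤s (s≤s b<m))) = tail (next (Cov⇒PeakCov c)) (s≤s b<m)
  closed c@(cOdd↑' _) (s≤s (s≤s (s≤s b<m))) = tail (next (Cov⇒PeakCov c)) (s≤s b<m)

upClosed⇒isFilterᵇ : (Y : Vec Bool (3 + m)) → UpClosed Cov₀ Y → T (isFilterᵇ Y)
upClosed⇒isFilterᵇ (x₁ ∷ x₂ ∷ x₃ ∷ v) cl = from T-∧
  (from T-→ᵇ (cl c21 (s≤s z≤n)) , from T-∧ (from T-→ᵇ (cl c32 (s≤s (s≤s z≤n))) , upClosed⇒fromValley tail))
  where
  tail : UpClosed ValleyCov (x₂ ∷ v)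
  tail first    (s≤s 1≤m) = cl c24 (s≤s (s≤s (s≤s 1≤m)))
  tail (next c) (s≤s b<m) = cl (PeakCov⇒Cov c) (s≤s (s≤s (s≤s b<m)))

count-isFilterᵇ : count (isFilterᵇ {m}) ≡ 2 * fib (3 + m)
count-isFilterᵇ {m} rewrite count-false {m} | count-fromValley-true {m} | count-fromValley-false {m} =
  double (fib (1 + m)) (fib m)
  where
  double : ∀ p q → p + p + (p + q) + (p + q) ≡ 2 * (p + q + p)
  double = solve-∀

isFilter⇔isFilterᵇ : (Y : Subset (3 + m)) → IsFilter (3 + m) Y ⇔ T (isFilterᵇ Y)
isFilter⇔isFilterᵇ Y = mk⇔
  (upClosed⇒isFilterᵇ Y ∘ to (isFilter⇔upClosed Y))
  (from (isFilter⇔upClosed Y) ∘ isFilterᵇ⇒upClosed Y)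

Σ-cong-⇔ : {A : Set} {P Q : A → Set} → (∀ {a} → Irrelevant (P a)) → (∀ {a} → Irrelevant (Q a)) →
  (∀ {a} → P a ⇔ Q a) → Σ A P ↔ Σ A Q
Σ-cong-⇔ P-irr Q-irr P⇔Q = mk↔ₛ′
  (λ (a , p) → a , to P⇔Q p) (λ (a , q) → a , from P⇔Q q)
  (λ (a , _) → cong (a ,_) (Q-irr _ _)) (λ (a , _) → cong (a ,_) (P-irr _ _))

filtersOfRank↔ : ∀ k → FiltersOfRank (3 + m) k ↔ Σ (Subset (3 + m)) (λ Y → T (isFilterᵇ Y ∧ (rank (3 + m) Y ≡ᵇ k)))
filtersOfRank↔ {m} k = Σ-cong-⇔ (λ (_ , e) (_ , e′) → cong (_ ,_) (≡-irrelevant e e′)) T-irrelevant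
  (λ {Y} → mk⇔
    (λ ([ F ] , e) → from T-∧ (recompute (T? _) (to (isFilter⇔isFilterᵇ Y) F) , ≡⇒≡ᵇ _ _ e))
    (λ t → [ from (isFilter⇔isFilterᵇ Y) (proj₁ (to T-∧ t)) ] , ≡ᵇ⇒≡ _ _ (proj₂ (to T-∧ t))))

corollary2 : (n : ℕ) → 3 ≤ n → (r : ℕ → ℕ)
    → (∀ k → k ≤ n → Fin (r k) ↔ FiltersOfRank n k)
    → sumTo n r ≡ 2 * fib n
corollary2 n@(suc (suc (suc m))) (s≤s (s≤s (s≤s _))) r r↔ = begin
  sumTo n r                                                   ≡⟨ sumTo-cong r _ r≡count ⟩
  sumTo n (λ k → count (λ Y → isFilterᵇ Y ∧ (rank n Y ≡ᵇ k))) ≡⟨ count-fibres (isFilterᵇ {m}) (rank n) (λ Y → m∸n≤m n ∣ Y ∣) ⟩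
  count (isFilterᵇ {m})                                       ≡⟨ count-isFilterᵇ {m} ⟩
  2 * fib n                                                   ∎
  where
  open ≡-Reasoning
  r≡count : ∀ k → k ≤ n → r k ≡ count (λ Y → isFilterᵇ Y ∧ (rank n Y ≡ᵇ k))
  r≡count k k≤n = ↔⇒≡ (↔-trans (r↔ k k≤n) (↔-trans (filtersOfRank↔ k) (Σ-T↔count _)))
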